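{- For every constant $\epsilon>0$ and every positive integer $\Delta$ there exists a deterministic distributed algorithm (in the synchronous port-numbering model described in the context) that, on every edge-weighted bicoloured graph $\mathcal{G}=(R\cup B,E)$ of maximum degree $\Delta$ with positive edge weights $w$, whose preferences are determined by the weights, outputs within $T\le 4+2\Delta/\epsilon$ synchronous communication steps a matching $M$ with $w(M^*)\le(2+\epsilon)\,w(M)$, where $M^*$ is a maximum-weight matching of $\mathcal{G}$.
   Context: A bicoloured graph is a simple undirected bipartite graph $\mathcal{G}=(R\cup B,E)$ without isolated nodes, with nodes in $R$ called red and in $B$ blue, every node knowing its own colour; $\Delta$ is the maximum degree. A matching is a set $M\subseteq E$ with each node incident to at most one edge of $M$; $w(M)=\sum_{e\in M}w(e)$. Preferences are determined by the weights: each node $v$ prefers its incident edges in order of weight, heaviest most preferred (i.e. if $w(\{v,x\})>w(\{v,y\})$ then $v$ prefers $x$ to $y$). Distributed model: $\mathcal{G}$ is the communication network. Initially each node $v$ knows only its colour, its degree $d(v)$, and the constant $T$; it has $d(v)$ ports to its neighbours, numbered according to $v$'s preferences (so the algorithm has access only to the relative order of weights at each node, not to identifiers). In each synchronous step every node receives messages from its neighbours, performs deterministic local computation, and sends a message to each neighbour. After $T$ steps each node outputs which neighbour, if any, is its partner, consistently ($u$ names $v$ iff $v$ names $u$).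
   Formalization: The constant ε is a positive rational and the edge weights w are positive rationals. -}

module Defs where

open import Data.Nat as ℕ using (ℕ; zero; suc; _≤_)
open import Data.Fin as Fin using (Fin)
open import Data.Bool using (Bool; true; false; not; if_then_else_)
open import Data.Maybe using (Maybe; just; nothing; maybe)
open import Data.Product using (Σ; ∃; _×_)
open import Data.Integer using (+_)
open import Data.Rational as ℚ using (ℚ; 0ℚ; _+_; _*_)
open import Relation.Binary.PropositionalEquality using (_≡_)

-- Nodes are Fin n; red v ≡ true means v is red, false means blue.
-- deg v is the degree d(v); nbr v i is the neighbour behind port i of v;
-- back v i is the port number at nbr v i which leads back to v.
record BGraph : Set where
  field
    n       : ℕ
    red     : Fin n → Bool
    deg     : Fin n → ℕ
    nbr     : (v : Fin n) → Fin (deg v) → Fin n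
    back    : (v : Fin n) (i : Fin (deg v)) → Fin (deg (nbr v i))
    back-ok : ∀ v i → nbr (nbr v i) (back v i) ≡ v
    bip     : ∀ v i → red (nbr v i) ≡ not (red v)
    simple  : ∀ v i j → nbr v i ≡ nbr v j → i ≡ j
    noIso   : ∀ v → 1 ≤ deg v
open BGraph public

MaxDegree : BGraph → ℕ → Set
MaxDegree G Δ = (∀ v → deg G v ≤ Δ) × ∃ λ v → deg G v ≡ Δ

-- Positive edge weights (a weight is attached to each port, equal at both
-- endpoints of an edge) such that ports are numbered according to the node's
-- preferences: lower port number = heavier (more preferred) edge.
record Weighting (G : BGraph) : Set where
  field
    wt   : (v : Fin (n G)) → Fin (deg G v) → ℚ
    sym  : ∀ v i → wt (nbr G v i) (back G v i) ≡ wt v i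
    pos  : ∀ v i → ℚ.Positive (wt v i)
    pref : ∀ v (i j : Fin (deg G v)) → i Fin.< j → wt v j ℚ.≤ wt v i
open Weighting public

Mate : BGraph → Set
Mate G = (v : Fin (n G)) → Maybe (Fin (deg G v))

-- consistency: u names v iff v names u; such an assignment is a matching
IsMatching : (G : BGraph) → Mate G → Set
IsMatching G m = ∀ v i → m v ≡ just i → m (nbr G v i) ≡ just (back G v i)

ΣFin : (k : ℕ) → (Fin k → ℚ) → ℚ
ΣFin zero    f = 0ℚ
ΣFin (suc k) f = f Fin.zero + ΣFin k (λ i → f (Fin.suc i))

-- w(M): every matching edge is counted once, at its red endpoint
weight : (G : BGraph) → Weighting G → Mate G → ℚ
weight G W m = ΣFin (n G) (λ v → if red G v then maybe (wt W v) 0ℚ (m v) else 0ℚ)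

IsMaxWeightMatching : (G : BGraph) → Weighting G → Mate G → Set
IsMaxWeightMatching G W m =
  IsMatching G m × (∀ m' → IsMatching G m' → weight G W m' ℚ.≤ weight G W m)

-- A node initially knows its colour and degree (and the constant T, built in).
-- In each step a node sends a message on each port (computed from its state),
-- then updates its state from the messages received, indexed by its own ports.
record Algorithm : Set₁ where
  field
    State   : Set
    Msg     : Set
    T       : ℕ
    init    : Bool → (d : ℕ) → State
    send    : (d : ℕ) → State → Fin d → Msg
    receive : (d : ℕ) → State → (Fin d → Msg) → State
    output  : (d : ℕ) → State → Maybe (Fin d)
open Algorithm public

run : (A : Algorithm) (G : BGraph) → ℕ → (v : Fin (n G)) → State A
run A G zero    v = init A (red G v) (deg G v)
run A G (suc t) v =
  receive A (deg G v) (run A G t v)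
    (λ i → send A (deg G (nbr G v i)) (run A G t (nbr G v i)) (back G v i))

out : (A : Algorithm) (G : BGraph) → Mate G
out A G v = output A (deg G v) (run A G (T A) v)

ℕtoℚ : ℕ → ℚ
ℕtoℚ k = (+ k) ℚ./ 1

-- The algorithm runs K = ⌊Δ/ε⌋ + 1 rounds of red-proposing deferred acceptance
-- (Gale–Shapley): red nodes propose along their ports in order of preference, each
-- blue node keeps the best proposal it has received, and the tentative pairs are
-- output. After every round, a blue node keeps the proposal of a red node exactly
-- when that red node is marked accepted, and every neighbour that a red node has
-- passed over keeps an edge at least as heavy as the one to that red node.
--
-- Let y(b) be the weight of the edge kept by the blue node b at the end, so that
-- Σ y = w(M). In each round every red node r pays for its edge in M* out of
-- y(blue node accepting r) + y(M*-partner of r) + (growth of the total y over the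
-- neighbours r has passed). Each blue node accepts one red node per round, is the
-- M*-partner of one red node, and is passed by at most Δ red nodes, so summing over
-- the K rounds gives K w(M*) ≤ (2K + Δ) w(M) ≤ K (2 + ε) w(M).

module Submission where

open import Defs renaming (sym to wt-sym)
open import Data.Nat as ℕ using (ℕ; zero; suc; NonZero)
import Data.Nat.Properties as ℕ
open import Data.Nat.Coprimality using (1-coprimeTo)
import Data.Nat.Coprimality as Coprime
open import Data.Nat.DivMod using (_/_; m/n*n≤m; m≡m%n+[m/n]*n; m%n<n)
import Data.Integer as ℤ
open import Data.Integer using (1ℤ)
import Data.Integer.Properties as ℤ
open import Data.Integer.Tactic.RingSolver using (solve-∀)
open import Data.Fin as Fin using (Fin; _≟_; toℕ)
open import Data.Fin.Properties using (any?; toℕ-injective; toℕ<n)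
open import Data.Bool using (Bool; true; false; not; if_then_else_; _∧_)
open import Data.Maybe as Maybe using (Maybe; just; nothing; maybe; _>>=_)
import Data.Maybe.Properties as Maybe
open import Data.Product using (Σ; _×_; _,_; proj₂)
open import Data.Sum using (inj₁; inj₂)
open import Data.Unit using (tt)
open import Data.Rational as ℚ using (ℚ; mkℚ; 0ℚ; 1ℚ; Positive; _+_; _*_; _≤_; _÷_; 1/_; toℚᵘ)
open import Data.Rational.Properties hiding (_≟_)
open import Data.Rational.Unnormalised as ℚᵘ using (mkℚᵘ; *≡*; *≤*)
import Data.Rational.Unnormalised.Properties as ℚᵘ
open import Data.Rational.Solver using (module +-*-Solver)
open import Algebra.Bundles using (CommutativeMonoid)
open import Algebra.Properties.CommutativeSemigroup (CommutativeMonoid.commutativeSemigroup +-0-commutativeMonoid)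
  using () renaming (interchange to +-interchange)
open import Relation.Nullary using (Dec; yes; no; does; ¬_; contradiction)
open import Relation.Nullary.Decidable using (dec-true)
open import Relation.Binary.PropositionalEquality
open import Function using (_∘_; _∘′_)

p≤q+p : ∀ {p q} → 0ℚ ≤ q → p ≤ q + p
p≤q+p {p} 0≤q = ≤-trans (≤-reflexive (sym (+-identityˡ p))) (+-monoˡ-≤ p 0≤q)

p≤p+q : ∀ {p q} → 0ℚ ≤ q → p ≤ p + q
p≤p+q {p} {q} 0≤q = ≤-trans (p≤q+p 0≤q) (≤-reflexive (+-comm q p))

0≤1 : 0ℚ ≤ 1ℚ
0≤1 = nonNegative⁻¹ 1ℚ

nonNeg+ : ∀ {p q} → 0ℚ ≤ p → 0ℚ ≤ q → 0ℚ ≤ p + q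
nonNeg+ 0≤p 0≤q = ≤-trans 0≤p (p≤p+q 0≤q)

toℚᵘ-ℕtoℚ : ∀ k → toℚᵘ (ℕtoℚ k) ≡ mkℚᵘ (ℤ.+ k) 0
toℚᵘ-ℕtoℚ k = cong toℚᵘ (normalize-coprime {k} {0} (Coprime.sym (1-coprimeTo k)))

ℕtoℚ-+ : ∀ m n → ℕtoℚ (m ℕ.+ n) ≡ ℕtoℚ m + ℕtoℚ n
ℕtoℚ-+ m n = toℚᵘ-injective (begin
  toℚᵘ (ℕtoℚ (m ℕ.+ n))                  ≡⟨ toℚᵘ-ℕtoℚ (m ℕ.+ n) ⟩
  mkℚᵘ (ℤ.+ m ℤ.+ ℤ.+ n) 0                ≈⟨ *≡* (ring (ℤ.+ m) (ℤ.+ n)) ⟩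
  mkℚᵘ (ℤ.+ m) 0 ℚᵘ.+ mkℚᵘ (ℤ.+ n) 0      ≡⟨ cong₂ ℚᵘ._+_ (toℚᵘ-ℕtoℚ m) (toℚᵘ-ℕtoℚ n) ⟨
  toℚᵘ (ℕtoℚ m) ℚᵘ.+ toℚᵘ (ℕtoℚ n)        ≈⟨ toℚᵘ-homo-+ (ℕtoℚ m) (ℕtoℚ n) ⟨
  toℚᵘ (ℕtoℚ m + ℕtoℚ n)                  ∎)
  where
  open ℚᵘ.≃-Reasoning
  ring : ∀ a b → (a ℤ.+ b) ℤ.* (1ℤ ℤ.* 1ℤ) ≡ (a ℤ.* 1ℤ ℤ.+ b ℤ.* 1ℤ) ℤ.* 1ℤ
  ring = solve-∀

ℕtoℚ-* : ∀ m n → ℕtoℚ (m ℕ.* n) ≡ ℕtoℚ m * ℕtoℚ n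
ℕtoℚ-* m n = toℚᵘ-injective (begin
  toℚᵘ (ℕtoℚ (m ℕ.* n))                  ≡⟨ toℚᵘ-ℕtoℚ (m ℕ.* n) ⟩
  mkℚᵘ (ℤ.+ (m ℕ.* n)) 0                  ≡⟨ cong (λ z → mkℚᵘ z 0) (ℤ.pos-* m n) ⟩
  mkℚᵘ (ℤ.+ m ℤ.* ℤ.+ n) 0                ≈⟨ *≡* (ring (ℤ.+ m) (ℤ.+ n)) ⟩
  mkℚᵘ (ℤ.+ m) 0 ℚᵘ.* mkℚᵘ (ℤ.+ n) 0      ≡⟨ cong₂ ℚᵘ._*_ (toℚᵘ-ℕtoℚ m) (toℚᵘ-ℕtoℚ n) ⟨
  toℚᵘ (ℕtoℚ m) ℚᵘ.* toℚᵘ (ℕtoℚ n)        ≈⟨ toℚᵘ-homo-* (ℕtoℚ m) (ℕtoℚ n) ⟨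
  toℚᵘ (ℕtoℚ m * ℕtoℚ n)                  ∎)
  where
  open ℚᵘ.≃-Reasoning
  ring : ∀ a b → (a ℤ.* b) ℤ.* (1ℤ ℤ.* 1ℤ) ≡ (a ℤ.* b) ℤ.* 1ℤ
  ring = solve-∀

ℕtoℚ-suc : ∀ k → ℕtoℚ (suc k) ≡ 1ℚ + ℕtoℚ k
ℕtoℚ-suc k = ℕtoℚ-+ 1 k

ℕtoℚ-mono-≤ : ∀ {m n} → m ℕ.≤ n → ℕtoℚ m ≤ ℕtoℚ n
ℕtoℚ-mono-≤ {m} {n} m≤n = toℚᵘ-cancel-≤
  (subst₂ ℚᵘ._≤_ (sym (toℚᵘ-ℕtoℚ m)) (sym (toℚᵘ-ℕtoℚ n))
    (*≤* (ℤ.*-monoʳ-≤-nonNeg 1ℤ (ℤ.+≤+ m≤n))))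

ℕtoℚ-nonNeg : ∀ k → 0ℚ ≤ ℕtoℚ k
ℕtoℚ-nonNeg k = ℕtoℚ-mono-≤ {0} {k} ℕ.z≤n

ℕtoℚ-pos : ∀ k → ℚ.Positive (ℕtoℚ (suc k))
ℕtoℚ-pos k = subst ℚ.Positive (sym (ℕtoℚ-suc k))
  (pos+nonNeg⇒pos 1ℚ (ℕtoℚ k) {{ℚ.nonNegative (ℕtoℚ-nonNeg k)}})

∃-floor : ∀ x → 0ℚ ≤ x → Σ ℕ λ q → ℕtoℚ q ≤ x × x ≤ ℕtoℚ (suc q)
∃-floor x@(mkℚ (ℤ.+ m) e _) _ = m / d , lower , upper
  where
  d = suc e
  instance _ = ℕtoℚ-pos e
  x*d≡m : x * ℕtoℚ d ≡ ℕtoℚ m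
  x*d≡m = toℚᵘ-injective (begin
    toℚᵘ (x * ℕtoℚ d)                   ≈⟨ toℚᵘ-homo-* x (ℕtoℚ d) ⟩
    mkℚᵘ (ℤ.+ m) e ℚᵘ.* toℚᵘ (ℕtoℚ d)   ≡⟨ cong (mkℚᵘ (ℤ.+ m) e ℚᵘ.*_) (toℚᵘ-ℕtoℚ d) ⟩
    mkℚᵘ (ℤ.+ m) e ℚᵘ.* mkℚᵘ (ℤ.+ d) 0  ≈⟨ *≡* (ring (ℤ.+ m) (ℤ.+ d)) ⟩
    mkℚᵘ (ℤ.+ m) 0                      ≡⟨ toℚᵘ-ℕtoℚ m ⟨
    toℚᵘ (ℕtoℚ m)                       ∎)
    where
    open ℚᵘ.≃-Reasoning
    ring : ∀ a b → (a ℤ.* b) ℤ.* 1ℤ ≡ a ℤ.* (b ℤ.* 1ℤ)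
    ring = solve-∀
  lower : ℕtoℚ (m / d) ≤ x
  lower = *-cancelʳ-≤-pos (ℕtoℚ d) (begin
    ℕtoℚ (m / d) * ℕtoℚ d  ≡⟨ sym (ℕtoℚ-* (m / d) d) ⟩
    ℕtoℚ (m / d ℕ.* d)     ≤⟨ ℕtoℚ-mono-≤ (m/n*n≤m m d) ⟩
    ℕtoℚ m                 ≡⟨ sym x*d≡m ⟩
    x * ℕtoℚ d             ∎)
    where open ≤-Reasoning
  m<[1+m/d]*d : m ℕ.< suc (m / d) ℕ.* d
  m<[1+m/d]*d = subst (ℕ._< suc (m / d) ℕ.* d) (sym (m≡m%n+[m/n]*n m d))
                      (ℕ.+-monoˡ-< (m / d ℕ.* d) (m%n<n m d))
  upper : x ≤ ℕtoℚ (suc (m / d))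
  upper = *-cancelʳ-≤-pos (ℕtoℚ d) (begin
    x * ℕtoℚ d                   ≡⟨ x*d≡m ⟩
    ℕtoℚ m                       ≤⟨ ℕtoℚ-mono-≤ (ℕ.<⇒≤ m<[1+m/d]*d) ⟩
    ℕtoℚ (suc (m / d) ℕ.* d)     ≡⟨ ℕtoℚ-* (suc (m / d)) d ⟩
    ℕtoℚ (suc (m / d)) * ℕtoℚ d  ∎)
    where open ≤-Reasoning
∃-floor (mkℚ ℤ.-[1+ _ ] _ _) x≥0 with () ← ℚ.nonNegative x≥0

telescope : ∀ t {a c : ℚ} (s : ℕ → ℚ) → (∀ j → j ℕ.< t → a + s j ≤ c + s (suc j)) →
  ℕtoℚ t * a + s 0 ≤ ℕtoℚ t * c + s t
telescope zero {a} {c} s step = ≤-reflexive (cong (_+ s 0) (trans (*-zeroˡ a) (sym (*-zeroˡ c))))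
telescope (suc t) {a} {c} s step = begin
  ℕtoℚ (suc t) * a + s 0         ≡⟨ cong (λ x → x * a + s 0) (ℕtoℚ-suc t) ⟩
  (1ℚ + ℕtoℚ t) * a + s 0        ≡⟨ lhs-≡ a (ℕtoℚ t) (s 0) ⟩
  a + (ℕtoℚ t * a + s 0)         ≤⟨ +-monoʳ-≤ a (telescope t s (λ j j<t → step j (ℕ.m<n⇒m<1+n j<t))) ⟩
  a + (ℕtoℚ t * c + s t)         ≡⟨ middle-≡ a (ℕtoℚ t * c) (s t) ⟩
  ℕtoℚ t * c + (a + s t)         ≤⟨ +-monoʳ-≤ (ℕtoℚ t * c) (step t (ℕ.n<1+n t)) ⟩
  ℕtoℚ t * c + (c + s (suc t))   ≡⟨ rhs-≡ c (ℕtoℚ t) (s (suc t)) ⟩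
  (1ℚ + ℕtoℚ t) * c + s (suc t)  ≡⟨ cong (λ x → x * c + s (suc t)) (ℕtoℚ-suc t) ⟨
  ℕtoℚ (suc t) * c + s (suc t)   ∎
  where
  open ≤-Reasoning
  open +-*-Solver
  lhs-≡ : ∀ a n x → (1ℚ + n) * a + x ≡ a + (n * a + x)
  lhs-≡ = solve 3 (λ a n x → (con 1ℚ :+ n) :* a :+ x := a :+ (n :* a :+ x)) refl
  middle-≡ : ∀ a y x → a + (y + x) ≡ y + (a + x)
  middle-≡ = solve 3 (λ a y x → a :+ (y :+ x) := y :+ (a :+ x)) refl
  rhs-≡ : ∀ c n x → n * c + (c + x) ≡ (1ℚ + n) * c + x
  rhs-≡ = solve 3 (λ c n x → n :* c :+ (c :+ x) := (con 1ℚ :+ n) :* c :+ x) refl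

-- Finite sums

_when_ : ∀ {a} {A : Set a} → ℚ → Dec A → ℚ
q when d = if does d then q else 0ℚ

when-nonNeg : ∀ {a} {A : Set a} {q} (d : Dec A) → 0ℚ ≤ q → 0ℚ ≤ q when d
when-nonNeg (yes _) 0≤q = 0≤q
when-nonNeg (no _)  _   = ≤-refl

when-≤ : ∀ {a} {A : Set a} {q} (d : Dec A) → 0ℚ ≤ q → q when d ≤ q
when-≤ (yes _) _   = ≤-refl
when-≤ (no _)  0≤q = 0≤q

when-mono : ∀ {a b} {A : Set a} {B : Set b} {q} → 0ℚ ≤ q → (A → B) →
  (d : Dec A) (e : Dec B) → q when d ≤ q when e
when-mono 0≤q A→B (yes a) (yes _) = ≤-refl
when-mono 0≤q A→B (yes a) (no ¬b) = contradiction (A→B a) ¬b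
when-mono 0≤q A→B (no _)  e       = when-nonNeg e 0≤q

when-≡ : ∀ {a b} {A : Set a} {B : Set b} {q} → (A → B) → (B → A) →
  (d : Dec A) (e : Dec B) → q when d ≡ q when e
when-≡ A→B B→A (yes _) (yes _) = refl
when-≡ A→B B→A (yes a) (no ¬b) = contradiction (A→B a) ¬b
when-≡ A→B B→A (no ¬a) (yes b) = contradiction (B→A b) ¬a
when-≡ A→B B→A (no _)  (no _)  = refl

when-yes : ∀ {a} {A : Set a} {q} → A → (d : Dec A) → q when d ≡ q
when-yes a (yes _) = refl
when-yes a (no ¬a) = contradiction a ¬a

when-no : ∀ {a} {A : Set a} {q} → ¬ A → (d : Dec A) → q when d ≡ 0ℚ
when-no ¬a (yes a) = contradiction a ¬a
when-no ¬a (no _)  = refl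

ΣFin-cong : ∀ k {f g : Fin k → ℚ} → (∀ i → f i ≡ g i) → ΣFin k f ≡ ΣFin k g
ΣFin-cong zero    f≗g = refl
ΣFin-cong (suc k) f≗g = cong₂ _+_ (f≗g Fin.zero) (ΣFin-cong k (f≗g ∘ Fin.suc))

ΣFin-mono-≤ : ∀ k {f g : Fin k → ℚ} → (∀ i → f i ≤ g i) → ΣFin k f ≤ ΣFin k g
ΣFin-mono-≤ zero    f≤g = ≤-refl
ΣFin-mono-≤ (suc k) f≤g = +-mono-≤ (f≤g Fin.zero) (ΣFin-mono-≤ k (f≤g ∘ Fin.suc))

ΣFin-zero : ∀ k → ΣFin k (λ _ → 0ℚ) ≡ 0ℚ
ΣFin-zero zero    = refl
ΣFin-zero (suc k) = trans (+-identityˡ _) (ΣFin-zero k)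

ΣFin-nonNeg : ∀ k {f : Fin k → ℚ} → (∀ i → 0ℚ ≤ f i) → 0ℚ ≤ ΣFin k f
ΣFin-nonNeg k 0≤f = ≤-trans (≤-reflexive (sym (ΣFin-zero k))) (ΣFin-mono-≤ k 0≤f)

ΣFin-+ : ∀ k (f g : Fin k → ℚ) → ΣFin k (λ i → f i + g i) ≡ ΣFin k f + ΣFin k g
ΣFin-+ zero    f g = sym (+-identityˡ 0ℚ)
ΣFin-+ (suc k) f g = begin
  (f₀ + g₀) + ΣFin k (λ i → f (Fin.suc i) + g (Fin.suc i))
    ≡⟨ cong ((f₀ + g₀) +_) (ΣFin-+ k (f ∘ Fin.suc) (g ∘ Fin.suc)) ⟩
  (f₀ + g₀) + (ΣFin k (f ∘ Fin.suc) + ΣFin k (g ∘ Fin.suc))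
    ≡⟨ +-interchange f₀ g₀ (ΣFin k (f ∘ Fin.suc)) (ΣFin k (g ∘ Fin.suc)) ⟩
  (f₀ + ΣFin k (f ∘ Fin.suc)) + (g₀ + ΣFin k (g ∘ Fin.suc)) ∎
  where
  open ≡-Reasoning
  f₀ = f Fin.zero
  g₀ = g Fin.zero

ΣFin-*ˡ : ∀ k c (f : Fin k → ℚ) → ΣFin k (λ i → c * f i) ≡ c * ΣFin k f
ΣFin-*ˡ zero    c f = sym (*-zeroʳ c)
ΣFin-*ˡ (suc k) c f = trans (cong (c * f Fin.zero +_) (ΣFin-*ˡ k c (f ∘ Fin.suc)))
                            (sym (*-distribˡ-+ c _ _))

ΣFin-*ʳ : ∀ k c (f : Fin k → ℚ) → ΣFin k (λ i → f i * c) ≡ ΣFin k f * c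
ΣFin-*ʳ k c f = trans (ΣFin-cong k (λ i → *-comm (f i) c))
                      (trans (ΣFin-*ˡ k c f) (*-comm c _))

ΣFin-comm : ∀ m n (f : Fin m → Fin n → ℚ) →
  ΣFin m (λ i → ΣFin n (f i)) ≡ ΣFin n (λ j → ΣFin m (λ i → f i j))
ΣFin-comm zero    n f = sym (ΣFin-zero n)
ΣFin-comm (suc m) n f = trans (cong (ΣFin n (f Fin.zero) +_) (ΣFin-comm m n (f ∘ Fin.suc)))
                              (sym (ΣFin-+ n (f Fin.zero) _))

ΣFin-const : ∀ k c → ΣFin k (λ _ → c) ≡ ℕtoℚ k * c
ΣFin-const zero    c = sym (*-zeroˡ c)
ΣFin-const (suc k) c = begin
  c + ΣFin k (λ _ → c)   ≡⟨ cong₂ _+_ (sym (*-identityˡ c)) (ΣFin-const k c) ⟩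
  1ℚ * c + ℕtoℚ k * c    ≡⟨ sym (*-distribʳ-+ c 1ℚ (ℕtoℚ k)) ⟩
  (1ℚ + ℕtoℚ k) * c      ≡⟨ cong (_* c) (sym (ℕtoℚ-suc k)) ⟩
  ℕtoℚ (suc k) * c       ∎
  where open ≡-Reasoning

ΣFin-point : ∀ k (x : Fin k) (f : Fin k → ℚ) → ΣFin k (λ i → f i when (x ≟ i)) ≡ f x
ΣFin-point (suc k) Fin.zero    f = trans (cong (f Fin.zero +_) (ΣFin-zero k)) (+-identityʳ _)
ΣFin-point (suc k) (Fin.suc x) f = trans (+-identityˡ _) (ΣFin-point k x (f ∘ Fin.suc))

ΣFin-term-≤ : ∀ k {f : Fin k → ℚ} → (∀ i → 0ℚ ≤ f i) → ∀ x → f x ≤ ΣFin k f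
ΣFin-term-≤ k {f} 0≤f x = begin
  f x                              ≡⟨ sym (ΣFin-point k x f) ⟩
  ΣFin k (λ i → f i when (x ≟ i))  ≤⟨ ΣFin-mono-≤ k (λ i → when-≤ (x ≟ i) (0≤f i)) ⟩
  ΣFin k f                         ∎
  where open ≤-Reasoning

ΣFin-<-suc : ∀ d (f : Fin d → ℚ) (k : Fin d) →
  ΣFin d (λ i → f i when (toℕ i ℕ.<? suc (toℕ k))) ≡
  ΣFin d (λ i → f i when (toℕ i ℕ.<? toℕ k)) + f k
ΣFin-<-suc d f k = begin
  ΣFin d (λ i → f i when (toℕ i ℕ.<? suc (toℕ k)))
    ≡⟨ ΣFin-cong d (λ i → split i (toℕ i ℕ.<? suc (toℕ k)) (toℕ i ℕ.<? toℕ k) (k ≟ i)) ⟩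
  ΣFin d (λ i → f i when (toℕ i ℕ.<? toℕ k) + f i when (k ≟ i))
    ≡⟨ ΣFin-+ d _ _ ⟩
  ΣFin d (λ i → f i when (toℕ i ℕ.<? toℕ k)) + ΣFin d (λ i → f i when (k ≟ i))
    ≡⟨ cong (ΣFin d (λ i → f i when (toℕ i ℕ.<? toℕ k)) +_) (ΣFin-point d k f) ⟩
  ΣFin d (λ i → f i when (toℕ i ℕ.<? toℕ k)) + f k ∎
  where
  open ≡-Reasoning
  split : ∀ i (p : Dec (toℕ i ℕ.< suc (toℕ k))) (q : Dec (toℕ i ℕ.< toℕ k)) (r : Dec (k ≡ i)) →
    f i when p ≡ f i when q + f i when r
  split i (yes _)   (yes i<k) (yes refl) = contradiction i<k (ℕ.<-irrefl refl)
  split i (yes _)   (yes _)   (no _)     = sym (+-identityʳ _)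
  split i (yes _)   (no _)    (yes _)    = sym (+-identityˡ _)
  split i (yes i≤k) (no i≮k)  (no k≢i)   =
    contradiction (toℕ-injective (ℕ.≤-antisym (ℕ.≮⇒≥ i≮k) (ℕ.s≤s⁻¹ i≤k))) k≢i
  split i (no i≰k)  (yes i<k) _          = contradiction (ℕ.m<n⇒m<1+n i<k) i≰k
  split i (no i≰k)  (no _)    (yes refl) = contradiction (ℕ.n<1+n (toℕ k)) i≰k
  split i (no _)    (no _)    (no _)     = sym (+-identityˡ 0ℚ)

ΣFin-double-count : ∀ m n (μ : Fin m → Fin n → ℚ) {G : Fin n → ℚ} {c} →
  (∀ s → 0ℚ ≤ G s) → (∀ s → ΣFin m (λ a → μ a s) ≤ c) →
  ΣFin m (λ a → ΣFin n (λ s → μ a s * G s)) ≤ c * ΣFin n G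
ΣFin-double-count m n μ {G} {c} 0≤G μ≤c = begin
  ΣFin m (λ a → ΣFin n (λ s → μ a s * G s))  ≡⟨ ΣFin-comm m n _ ⟩
  ΣFin n (λ s → ΣFin m (λ a → μ a s * G s))  ≡⟨ ΣFin-cong n (λ s → ΣFin-*ʳ m (G s) (λ a → μ a s)) ⟩
  ΣFin n (λ s → ΣFin m (λ a → μ a s) * G s)  ≤⟨ ΣFin-mono-≤ n μG≤cG ⟩
  ΣFin n (λ s → c * G s)                     ≡⟨ ΣFin-*ˡ n c G ⟩
  c * ΣFin n G                               ∎
  where
  open ≤-Reasoning
  μG≤cG : ∀ s → ΣFin m (λ a → μ a s) * G s ≤ c * G s
  μG≤cG s = *-monoʳ-≤-nonNeg (G s) {{ℚ.nonNegative (0≤G s)}} (μ≤c s)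

χ : ∀ {n} → Maybe (Fin n) → Fin n → ℚ
χ m s = 1ℚ when Maybe.≡-dec _≟_ m (just s)

χ-nonNeg : ∀ {n} (m : Maybe (Fin n)) s → 0ℚ ≤ χ m s
χ-nonNeg m s = when-nonNeg (Maybe.≡-dec _≟_ m (just s)) 0≤1

maybe-as-ΣFin : ∀ n (m : Maybe (Fin n)) (G : Fin n → ℚ) →
  maybe G 0ℚ m ≡ ΣFin n (λ s → χ m s * G s)
maybe-as-ΣFin n nothing  G = sym (trans (ΣFin-cong n (λ s → *-zeroˡ (G s))) (ΣFin-zero n))
maybe-as-ΣFin n (just x) G = sym (trans (ΣFin-cong n (λ s → χ*G (x ≟ s))) (ΣFin-point n x G))
  where
  χ*G : ∀ {s} (d : Dec (x ≡ s)) → (1ℚ when d) * G s ≡ G s when d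
  χ*G {s} (yes _) = *-identityˡ (G s)
  χ*G {s} (no _)  = *-zeroˡ (G s)

PartialInjective : ∀ {m n} → (Fin m → Maybe (Fin n)) → Set
PartialInjective φ = ∀ {a b s} → φ a ≡ just s → φ b ≡ just s → a ≡ b

PartialInjective-⊆ : ∀ {m n} {φ ψ : Fin m → Maybe (Fin n)} → PartialInjective φ →
  (∀ {a s} → ψ a ≡ just s → φ a ≡ just s) → PartialInjective ψ
PartialInjective-⊆ φ-inj ψ⊆φ ψa≡s ψb≡s = φ-inj (ψ⊆φ ψa≡s) (ψ⊆φ ψb≡s)

ΣFin-χ-≤1 : ∀ m {n} (φ : Fin m → Maybe (Fin n)) → PartialInjective φ →
  ∀ s → ΣFin m (λ a → χ (φ a) s) ≤ 1ℚ
ΣFin-χ-≤1 m φ φ-inj s with any? (λ a → Maybe.≡-dec _≟_ (φ a) (just s))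
... | yes (a₀ , φa₀≡s) = ≤-reflexive (trans (ΣFin-cong m χ≡δ) (ΣFin-point m a₀ (λ _ → 1ℚ)))
  where
  χ≡δ : ∀ a → χ (φ a) s ≡ 1ℚ when (a₀ ≟ a)
  χ≡δ a = when-≡ (λ φa≡s → φ-inj φa₀≡s φa≡s) (λ { refl → φa₀≡s })
          (Maybe.≡-dec _≟_ (φ a) (just s)) (a₀ ≟ a)
... | no ∄a = ≤-trans (≤-reflexive (trans (ΣFin-cong m χ≡0) (ΣFin-zero m))) 0≤1
  where
  χ≡0 : ∀ a → χ (φ a) s ≡ 0ℚ
  χ≡0 a = when-no (λ φa≡s → ∄a (a , φa≡s)) (Maybe.≡-dec _≟_ (φ a) (just s))

ΣFin-reindex-≤ : ∀ m n (φ : Fin m → Maybe (Fin n)) → PartialInjective φ →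
  {G : Fin n → ℚ} → (∀ s → 0ℚ ≤ G s) → ΣFin m (λ a → maybe G 0ℚ (φ a)) ≤ ΣFin n G
ΣFin-reindex-≤ m n φ φ-inj {G} 0≤G = begin
  ΣFin m (λ a → maybe G 0ℚ (φ a))
    ≡⟨ ΣFin-cong m (λ a → maybe-as-ΣFin n (φ a) G) ⟩
  ΣFin m (λ a → ΣFin n (λ s → χ (φ a) s * G s))
    ≤⟨ ΣFin-double-count m n (λ a → χ (φ a)) 0≤G (ΣFin-χ-≤1 m φ φ-inj) ⟩
  1ℚ * ΣFin n G
    ≡⟨ *-identityˡ _ ⟩
  ΣFin n G ∎
  where open ≤-Reasoning

-- Sums over neighbourhoods

module _ (G : BGraph) where

  private
    N = n G

  back-back : ∀ v i → toℕ (back G (nbr G v i) (back G v i)) ≡ toℕ i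
  back-back v i = go (back-ok G v i) (back G (nbr G v i) (back G v i)) (back-ok G (nbr G v i) (back G v i))
    where
    go : ∀ {w} → w ≡ v → (k : Fin (deg G w)) → nbr G w k ≡ nbr G v i → toℕ k ≡ toℕ i
    go refl k eq = cong toℕ (simple G v k i eq)

  nbr-blue : ∀ {r} q → red G r ≡ true → red G (nbr G r q) ≡ false
  nbr-blue {r} q r-red = trans (bip G r q) (cong not r-red)

  nbr-red : ∀ {b} k → red G b ≡ false → red G (nbr G b k) ≡ true
  nbr-red {b} k b-blue = trans (bip G b k) (cong not b-blue)

  ports : Fin N → Fin N → ℚ
  ports v u = ΣFin (deg G v) (λ q → χ (just (nbr G v q)) u)

  ports-≤ : ∀ u v → ports v u ≤ ports u v
  ports-≤ u v with any? (λ q → nbr G v q ≟ u)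
  ... | yes (q , refl) = begin
    ports v (nbr G v q)
      ≤⟨ ΣFin-χ-≤1 (deg G v) (just ∘ nbr G v) nbr-injective (nbr G v q) ⟩
    1ℚ
      ≡⟨ when-yes (cong just (back-ok G v q)) (Maybe.≡-dec _≟_ _ _) ⟨
    χ (just (nbr G u (back G v q))) v
      ≤⟨ ΣFin-term-≤ (deg G u) (λ i → χ-nonNeg (just (nbr G u i)) v) (back G v q) ⟩
    ports u v ∎
    where
    open ≤-Reasoning
    nbr-injective : PartialInjective (just ∘ nbr G v)
    nbr-injective eq eq′ = simple G v _ _ (Maybe.just-injective (trans eq (sym eq′)))
  ... | no ∄q = begin
    ports v u                  ≡⟨ ΣFin-cong (deg G v) (λ q → when-no (¬port q) (Maybe.≡-dec _≟_ _ _)) ⟩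
    ΣFin (deg G v) (λ _ → 0ℚ)  ≡⟨ ΣFin-zero (deg G v) ⟩
    0ℚ                         ≤⟨ ΣFin-nonNeg (deg G u) (λ i → χ-nonNeg (just (nbr G u i)) v) ⟩
    ports u v                  ∎
    where
    open ≤-Reasoning
    ¬port : ∀ q → just (nbr G v q) ≢ just u
    ¬port q eq = ∄q (q , Maybe.just-injective eq)

  ΣFin-ports-≤ : ∀ u → ΣFin N (λ v → ports v u) ≤ ℕtoℚ (deg G u)
  ΣFin-ports-≤ u = begin
    ΣFin N (λ v → ports v u)
      ≤⟨ ΣFin-mono-≤ N (ports-≤ u) ⟩
    ΣFin N (ports u)
      ≡⟨ ΣFin-comm N (deg G u) _ ⟩
    ΣFin (deg G u) (λ i → ΣFin N (χ (just (nbr G u i))))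
      ≡⟨ ΣFin-cong (deg G u) (λ i → ΣFin-point N (nbr G u i) _) ⟩
    ΣFin (deg G u) (λ _ → 1ℚ)
      ≡⟨ ΣFin-const (deg G u) 1ℚ ⟩
    ℕtoℚ (deg G u) * 1ℚ
      ≡⟨ *-identityʳ _ ⟩
    ℕtoℚ (deg G u) ∎
    where open ≤-Reasoning

  ΣFin-nbr-≤ : ∀ Δ → (∀ v → deg G v ℕ.≤ Δ) → {H : Fin N → ℚ} → (∀ u → 0ℚ ≤ H u) →
    ΣFin N (λ v → ΣFin (deg G v) (λ q → H (nbr G v q))) ≤ ℕtoℚ Δ * ΣFin N H
  ΣFin-nbr-≤ Δ deg≤Δ {H} 0≤H = begin
    ΣFin N (λ v → ΣFin (deg G v) (λ q → H (nbr G v q)))  ≡⟨ ΣFin-cong N as-ports ⟩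
    ΣFin N (λ v → ΣFin N (λ u → ports v u * H u))        ≤⟨ ΣFin-double-count N N ports 0≤H ports≤Δ ⟩
    ℕtoℚ Δ * ΣFin N H                                    ∎
    where
    open ≤-Reasoning
    as-ports : ∀ v → ΣFin (deg G v) (λ q → H (nbr G v q)) ≡ ΣFin N (λ u → ports v u * H u)
    as-ports v = begin-equality
      ΣFin (deg G v) (λ q → H (nbr G v q))
        ≡⟨ ΣFin-cong (deg G v) (λ q → maybe-as-ΣFin N (just (nbr G v q)) H) ⟩
      ΣFin (deg G v) (λ q → ΣFin N (λ u → χ (just (nbr G v q)) u * H u))
        ≡⟨ ΣFin-comm (deg G v) N _ ⟩
      ΣFin N (λ u → ΣFin (deg G v) (λ q → χ (just (nbr G v q)) u * H u))
        ≡⟨ ΣFin-cong N (λ u → ΣFin-*ʳ (deg G v) (H u) _) ⟩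
      ΣFin N (λ u → ports v u * H u) ∎
    ports≤Δ : ∀ u → ΣFin N (λ v → ports v u) ≤ ℕtoℚ Δ
    ports≤Δ u = ≤-trans (ΣFin-ports-≤ u) (ℕtoℚ-mono-≤ (deg≤Δ u))

-- The proposal algorithm

if-just : ∀ {A : Set} {c} {x : Maybe A} {y} → (if c then x else nothing) ≡ just y →
  c ≡ true × x ≡ just y
if-just {c = true} eq = refl , eq

>>=-just : ∀ {A B : Set} (x : Maybe A) {f : A → Maybe B} {y} → (x >>= f) ≡ just y →
  Σ A λ a → x ≡ just a × f a ≡ just y
>>=-just (just a) eq = a , refl , eq

map-just⁻¹ : ∀ {A B : Set} {f : A → B} (x : Maybe A) {y} → Maybe.map f x ≡ just y →
  Σ A λ a → x ≡ just a × f a ≡ y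
map-just⁻¹ (just a) refl = a , refl , refl

fromℕ? : (d k : ℕ) → Maybe (Fin d)
fromℕ? zero    k       = nothing
fromℕ? (suc d) zero    = just Fin.zero
fromℕ? (suc d) (suc k) = Maybe.map Fin.suc (fromℕ? d k)

fromℕ?-toℕ : ∀ {d} (k : Fin d) → fromℕ? d (toℕ k) ≡ just k
fromℕ?-toℕ Fin.zero    = refl
fromℕ?-toℕ (Fin.suc k) = cong (Maybe.map Fin.suc) (fromℕ?-toℕ k)

fromℕ?-just : ∀ d m {k : Fin d} → fromℕ? d m ≡ just k → toℕ k ≡ m
fromℕ?-just (suc d) zero    refl = refl
fromℕ?-just (suc d) (suc m) eq with fromℕ? d m in eq′
fromℕ?-just (suc d) (suc m) refl | just k = cong suc (fromℕ?-just d m eq′)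

fromℕ?-nothing : ∀ d m → fromℕ? d m ≡ nothing → d ℕ.≤ m
fromℕ?-nothing zero    m       _  = ℕ.z≤n
fromℕ?-nothing (suc d) (suc m) eq with fromℕ? d m in eq′
... | nothing = ℕ.s≤s (fromℕ?-nothing d m eq′)

firstTrue : ∀ d → (Fin d → Bool) → Maybe (Fin d)
firstTrue zero    f = nothing
firstTrue (suc d) f =
  if f Fin.zero then just Fin.zero else Maybe.map Fin.suc (firstTrue d (f ∘ Fin.suc))

firstTrue-cong : ∀ d {f g : Fin d → Bool} → (∀ i → f i ≡ g i) → firstTrue d f ≡ firstTrue d g
firstTrue-cong zero    f≗g = refl
firstTrue-cong (suc d) f≗g rewrite f≗g Fin.zero | firstTrue-cong d (f≗g ∘ Fin.suc) = refl

firstTrue-true : ∀ d (f : Fin d → Bool) {i} → firstTrue d f ≡ just i → f i ≡ true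
firstTrue-true (suc d) f eq with f Fin.zero in f₀
firstTrue-true (suc d) f refl | true = f₀
... | false with firstTrue d (f ∘ Fin.suc) in eq′
firstTrue-true (suc d) f refl | false | just i = firstTrue-true d (f ∘ Fin.suc) eq′

firstTrue-least : ∀ d (f : Fin d → Bool) {j} → f j ≡ true →
  Σ (Fin d) λ i → firstTrue d f ≡ just i × toℕ i ℕ.≤ toℕ j
firstTrue-least (suc d) f {j} fj with f Fin.zero in f₀
... | true = Fin.zero , refl , ℕ.z≤n
firstTrue-least (suc d) f {Fin.zero}  fj | false = contradiction (trans (sym f₀) fj) λ ()
firstTrue-least (suc d) f {Fin.suc j} fj | false with firstTrue-least d (f ∘ Fin.suc) fj
... | i , eq , i≤j rewrite eq = Fin.suc i , refl , ℕ.s≤s i≤j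

holds : Maybe ℕ → ℕ → Bool
holds x k = does (Maybe.≡-dec ℕ._≟_ x (just k))

holds-true : ∀ x k → holds x k ≡ true → x ≡ just k
holds-true x k eq with Maybe.≡-dec ℕ._≟_ x (just k)
... | yes x≡k = x≡k

holds-false : ∀ x k → holds x k ≡ false → x ≢ just k
holds-false x k eq with Maybe.≡-dec ℕ._≟_ x (just k)
... | no x≢k = x≢k

-- A round takes two steps. Every red node proposes along port `proposal`, its
-- most preferred neighbour that has not refused it yet; every blue node keeps
-- the best proposal it receives (`holding`) and replies to it; a red node that
-- is not kept moves on to its next port. Ports are stored as natural numbers,
-- since the state type cannot depend on the degree, and read back with `fromℕ?`.
record NodeState : Set where
  field
    isRed    : Bool
    replying : Bool
    proposal : ℕ
    accepted : Bool
    holding  : Maybe ℕ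
open NodeState

sendProposal : ∀ d → NodeState → Fin d → Bool
sendProposal d s i = isRed s ∧ does (toℕ i ℕ.≟ proposal s)

sendReply : ∀ d → NodeState → Fin d → Bool
sendReply d s i = not (isRed s) ∧ holds (holding s) (toℕ i)

receiveProposals : ∀ d → NodeState → (Fin d → Bool) → NodeState
receiveProposals d s m = if isRed s
  then record s { replying = true }
  else record s { replying = true ; holding = Maybe.map toℕ (firstTrue d m) }

answerReply : ∀ d → NodeState → (Fin d → Bool) → Maybe (Fin d) → NodeState
answerReply d s m nothing  = record s { replying = false ; accepted = false }
answerReply d s m (just k) = if m k
  then record s { replying = false ; accepted = true }
  else record s { replying = false ; accepted = false ; proposal = suc (proposal s) }

receiveReply : ∀ d → NodeState → (Fin d → Bool) → NodeState
receiveReply d s m = if isRed s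
  then answerReply d s m (fromℕ? d (proposal s))
  else record s { replying = false }

twice : ℕ → ℕ
twice zero    = zero
twice (suc j) = suc (suc (twice j))

proposalAlgorithm : ℕ → Algorithm
proposalAlgorithm K = record
  { State   = NodeState
  ; Msg     = Bool
  ; T       = twice K
  ; init    = λ c _ → record
                { isRed = c ; replying = false ; proposal = 0 ; accepted = false ; holding = nothing }
  ; send    = λ d s → if replying s then sendReply d s else sendProposal d s
  ; receive = λ d s → if replying s then receiveReply d s else receiveProposals d s
  ; output  = λ d s → if isRed s
                        then (if accepted s then fromℕ? d (proposal s) else nothing)
                        else (holding s >>= fromℕ? d)
  }

isRed-receiveProposals : ∀ d s m → isRed (receiveProposals d s m) ≡ isRed s
isRed-receiveProposals d s m with isRed s
... | true  = refl
... | false = refl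

isRed-answerReply : ∀ d s m x → isRed (answerReply d s m x) ≡ isRed s
isRed-answerReply d s m nothing  = refl
isRed-answerReply d s m (just k) with m k
... | true  = refl
... | false = refl

isRed-receiveReply : ∀ d s m → isRed (receiveReply d s m) ≡ isRed s
isRed-receiveReply d s m with isRed s in s-red
... | true  = trans (isRed-answerReply d s m (fromℕ? d (proposal s))) s-red
... | false = refl

replying-receiveProposals : ∀ d s m → replying (receiveProposals d s m) ≡ true
replying-receiveProposals d s m with isRed s
... | true  = refl
... | false = refl

replying-answerReply : ∀ d s m x → replying (answerReply d s m x) ≡ false
replying-answerReply d s m nothing  = refl
replying-answerReply d s m (just k) with m k
... | true  = refl
... | false = refl

replying-receiveReply : ∀ d s m → replying (receiveReply d s m) ≡ false
replying-receiveReply d s m with isRed s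
... | true  = replying-answerReply d s m (fromℕ? d (proposal s))
... | false = refl

module _ d s (m : Fin d → Bool) (s-blue : isRed s ≡ false) where

  holding-receiveProposals : holding (receiveProposals d s m) ≡ Maybe.map toℕ (firstTrue d m)
  holding-receiveProposals rewrite s-blue = refl

  holding-receiveReply : holding (receiveReply d s m) ≡ holding s
  holding-receiveReply rewrite s-blue = refl

proposal-receiveProposals : ∀ d s m → proposal (receiveProposals d s m) ≡ proposal s
proposal-receiveProposals d s m with isRed s
... | true  = refl
... | false = refl

module _ d s (m : Fin d → Bool) (s-red : isRed s ≡ true) where

  receiveReply-exhausted : fromℕ? d (proposal s) ≡ nothing →
    proposal (receiveReply d s m) ≡ proposal s × accepted (receiveReply d s m) ≡ false
  receiveReply-exhausted none rewrite s-red | none = refl , refl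

  receiveReply-accept : ∀ {k} → fromℕ? d (proposal s) ≡ just k → m k ≡ true →
    proposal (receiveReply d s m) ≡ proposal s × accepted (receiveReply d s m) ≡ true
  receiveReply-accept port mk rewrite s-red | port | mk = refl , refl

  receiveReply-reject : ∀ {k} → fromℕ? d (proposal s) ≡ just k → m k ≡ false →
    proposal (receiveReply d s m) ≡ suc (proposal s) × accepted (receiveReply d s m) ≡ false
  receiveReply-reject port mk rewrite s-red | port | mk = refl , refl

isRed-receive : ∀ {K} d s m → isRed (receive (proposalAlgorithm K) d s m) ≡ isRed s
isRed-receive d s m with replying s
... | true  = isRed-receiveReply d s m
... | false = isRed-receiveProposals d s m

module Execution (K : ℕ) (G : BGraph) where

  private
    𝒜 = proposalAlgorithm K
    N = n G

  isRed-run : ∀ t v → isRed (run 𝒜 G t v) ≡ red G v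
  isRed-run zero    v = refl
  isRed-run (suc t) v = trans (isRed-receive {K} (deg G v) (run 𝒜 G t v) _) (isRed-run t v)

  -- Opaque: otherwise every goal about round suc j unfolds the execution up to that round.
  opaque
    atRound midRound : ℕ → Fin N → NodeState
    atRound  j = run 𝒜 G (twice j)
    midRound j = run 𝒜 G (suc (twice j))

    atRound-≡-run : ∀ j v → atRound j v ≡ run 𝒜 G (twice j) v
    atRound-≡-run j v = refl

  proposalInbox replyInbox : ℕ → (v : Fin N) → Fin (deg G v) → Bool
  proposalInbox j v i = send 𝒜 (deg G (nbr G v i)) (atRound j (nbr G v i)) (back G v i)
  replyInbox    j v i = send 𝒜 (deg G (nbr G v i)) (midRound j (nbr G v i)) (back G v i)

  opaque
    unfolding atRound midRound

    atRound-zero : ∀ v → atRound 0 v ≡ init 𝒜 (red G v) (deg G v)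
    atRound-zero v = refl

    isRed-atRound : ∀ j v → isRed (atRound j v) ≡ red G v
    isRed-atRound j = isRed-run (twice j)

    isRed-midRound : ∀ j v → isRed (midRound j v) ≡ red G v
    isRed-midRound j = isRed-run (suc (twice j))

    replying-atRound  : ∀ j v → replying (atRound j v) ≡ false
    replying-midRound : ∀ j v → replying (midRound j v) ≡ true
    replying-atRound zero    v = refl
    replying-atRound (suc j) v rewrite replying-midRound j v =
      replying-receiveReply (deg G v) (midRound j v) (replyInbox j v)
    replying-midRound j v rewrite replying-atRound j v =
      replying-receiveProposals (deg G v) (atRound j v) (proposalInbox j v)

    midRound-≡ : ∀ j v → midRound j v ≡ receiveProposals (deg G v) (atRound j v) (proposalInbox j v)
    midRound-≡ j v rewrite replying-atRound j v = refl

    atRound-suc-≡ : ∀ j v → atRound (suc j) v ≡ receiveReply (deg G v) (midRound j v) (replyInbox j v)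
    atRound-suc-≡ j v rewrite replying-midRound j v = refl

  prop : ℕ → Fin N → ℕ
  prop j r = proposal (atRound j r)

  acc : ℕ → Fin N → Bool
  acc j r = accepted (atRound j r)

  held : ℕ → Fin N → Maybe ℕ
  held j b = holding (atRound j b)

  prop-zero : ∀ r → prop 0 r ≡ 0
  prop-zero r = cong proposal (atRound-zero r)

  acc-zero : ∀ r → acc 0 r ≡ false
  acc-zero r = cong accepted (atRound-zero r)

  held-zero : ∀ b → held 0 b ≡ nothing
  held-zero b = cong holding (atRound-zero b)

  proposes : ℕ → (b : Fin N) → Fin (deg G b) → Bool
  proposes j b i = does (toℕ (back G b i) ℕ.≟ prop j (nbr G b i))

  bestProposal : ℕ → (b : Fin N) → Maybe (Fin (deg G b))
  bestProposal j b = firstTrue (deg G b) (proposes j b)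

  proposalInbox-≡ : ∀ j b i → red G b ≡ false → proposalInbox j b i ≡ proposes j b i
  proposalInbox-≡ j b i b-blue
    rewrite replying-atRound j (nbr G b i) | isRed-atRound j (nbr G b i) | bip G b i | b-blue = refl

  replyInbox-≡ : ∀ j r k → red G r ≡ true →
    replyInbox j r k ≡ holds (holding (midRound j (nbr G r k))) (toℕ (back G r k))
  replyInbox-≡ j r k r-red
    rewrite replying-midRound j (nbr G r k) | isRed-midRound j (nbr G r k) | bip G r k | r-red = refl

  holding-midRound : ∀ j b → red G b ≡ false →
    holding (midRound j b) ≡ Maybe.map toℕ (bestProposal j b)
  holding-midRound j b b-blue = begin
    holding (midRound j b)
      ≡⟨ cong holding (midRound-≡ j b) ⟩
    holding (receiveProposals (deg G b) (atRound j b) (proposalInbox j b))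
      ≡⟨ holding-receiveProposals _ (atRound j b) (proposalInbox j b) (trans (isRed-atRound j b) b-blue) ⟩
    Maybe.map toℕ (firstTrue (deg G b) (proposalInbox j b))
      ≡⟨ cong (Maybe.map toℕ) (firstTrue-cong (deg G b) (λ i → proposalInbox-≡ j b i b-blue)) ⟩
    Maybe.map toℕ (bestProposal j b) ∎
    where open ≡-Reasoning

  held-suc : ∀ j b → red G b ≡ false → held (suc j) b ≡ Maybe.map toℕ (bestProposal j b)
  held-suc j b b-blue = begin
    held (suc j) b
      ≡⟨ cong holding (atRound-suc-≡ j b) ⟩
    holding (receiveReply (deg G b) (midRound j b) (replyInbox j b))
      ≡⟨ holding-receiveReply _ (midRound j b) (replyInbox j b) (trans (isRed-midRound j b) b-blue) ⟩
    holding (midRound j b)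
      ≡⟨ holding-midRound j b b-blue ⟩
    Maybe.map toℕ (bestProposal j b) ∎
    where open ≡-Reasoning

  held-suc-≡ : ∀ j b → red G b ≡ false → ∀ {x} → bestProposal j b ≡ x →
    held (suc j) b ≡ Maybe.map toℕ x
  held-suc-≡ j b b-blue best≡x = trans (held-suc j b b-blue) (cong (Maybe.map toℕ) best≡x)

  proposes-true : ∀ j b k → proposes j b k ≡ true → toℕ (back G b k) ≡ prop j (nbr G b k)
  proposes-true j b k eq =
    ℕ.≡ᵇ⇒≡ (toℕ (back G b k)) (prop j (nbr G b k)) (subst Data.Bool.T (sym eq) tt)

  proposes-back : ∀ j r {k} → fromℕ? (deg G r) (prop j r) ≡ just k →
    proposes j (nbr G r k) (back G r k) ≡ true
  proposes-back j r {k} port = dec-true (_ ℕ.≟ _) (begin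
    toℕ (back G (nbr G r k) (back G r k))  ≡⟨ back-back G r k ⟩
    toℕ k                                  ≡⟨ fromℕ?-just (deg G r) (prop j r) port ⟩
    prop j r                               ≡⟨ cong (prop j) (back-ok G r k) ⟨
    prop j (nbr G (nbr G r k) (back G r k)) ∎)
    where open ≡-Reasoning

  held-suc-≤ : ∀ j b → red G b ≡ false → ∀ {k} → proposes j b k ≡ true →
    Σ (Fin (deg G b)) λ i → held (suc j) b ≡ just (toℕ i) × toℕ i ℕ.≤ toℕ k
  held-suc-≤ j b b-blue proposal with firstTrue-least (deg G b) (proposes j b) proposal
  ... | i , best≡i , i≤k = i , held-suc-≡ j b b-blue best≡i , i≤k

  held-back : ∀ t b {k : Fin (deg G b)} → held t b ≡ just (toℕ k) →
    held t (nbr G (nbr G b k) (back G b k)) ≡ just (toℕ (back G (nbr G b k) (back G b k)))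
  held-back t b {k} held≡k = begin
    held t (nbr G (nbr G b k) (back G b k))       ≡⟨ cong (held t) (back-ok G b k) ⟩
    held t b                                     ≡⟨ held≡k ⟩
    just (toℕ k)                                 ≡⟨ cong just (back-back G b k) ⟨
    just (toℕ (back G (nbr G b k) (back G b k))) ∎
    where open ≡-Reasoning

  data RedStep (j : ℕ) (r : Fin N) : Set where
    exhausted   : fromℕ? (deg G r) (prop j r) ≡ nothing →
                  prop (suc j) r ≡ prop j r → acc (suc j) r ≡ false → RedStep j r
    accepted-by : ∀ k → fromℕ? (deg G r) (prop j r) ≡ just k →
                  held (suc j) (nbr G r k) ≡ just (toℕ (back G r k)) →
                  prop (suc j) r ≡ prop j r → acc (suc j) r ≡ true → RedStep j r
    rejected-by : ∀ k → fromℕ? (deg G r) (prop j r) ≡ just k →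
                  held (suc j) (nbr G r k) ≢ just (toℕ (back G r k)) →
                  prop (suc j) r ≡ suc (prop j r) → acc (suc j) r ≡ false → RedStep j r

  module _ (j : ℕ) (r : Fin N) (r-red : red G r ≡ true) where

    private
      d = deg G r
      s = midRound j r
      m = replyInbox j r
      s-red : isRed s ≡ true
      s-red = trans (isRed-midRound j r) r-red
      prop-mid : proposal s ≡ prop j r
      prop-mid = trans (cong proposal (midRound-≡ j r))
                       (proposal-receiveProposals d (atRound j r) (proposalInbox j r))
      port-mid : ∀ {x} → fromℕ? d (prop j r) ≡ x → fromℕ? d (proposal s) ≡ x
      port-mid = trans (cong (fromℕ? d) prop-mid)
      prop-suc : prop (suc j) r ≡ proposal (receiveReply d s m)
      prop-suc = cong proposal (atRound-suc-≡ j r)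
      acc-suc : acc (suc j) r ≡ accepted (receiveReply d s m)
      acc-suc = cong accepted (atRound-suc-≡ j r)
      reply≡ : ∀ k → m k ≡ holds (held (suc j) (nbr G r k)) (toℕ (back G r k))
      reply≡ k = trans (replyInbox-≡ j r k r-red)
        (cong (λ x → holds x (toℕ (back G r k)))
              (trans (holding-midRound j (nbr G r k) b-blue) (sym (held-suc j (nbr G r k) b-blue))))
        where b-blue = nbr-blue G k r-red

    redStep : RedStep j r
    redStep with fromℕ? (deg G r) (prop j r) in port
    ... | nothing with receiveReply-exhausted d s m s-red (port-mid port)
    ...   | p≡ , a≡ = exhausted port (trans prop-suc (trans p≡ prop-mid)) (trans acc-suc a≡)
    redStep | just k with holds (held (suc j) (nbr G r k)) (toℕ (back G r k)) in reply
    ... | true with receiveReply-accept d s m s-red (port-mid port) (trans (reply≡ k) reply)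
    ...   | p≡ , a≡ = accepted-by k port (holds-true _ _ reply)
                        (trans prop-suc (trans p≡ prop-mid)) (trans acc-suc a≡)
    redStep | just k | false with receiveReply-reject d s m s-red (port-mid port) (trans (reply≡ k) reply)
    ...   | p≡ , a≡ = rejected-by k port (holds-false _ _ reply)
                        (trans prop-suc (trans p≡ (cong suc prop-mid))) (trans acc-suc a≡)

  mateAt : ℕ → Mate G
  mateAt j v = output 𝒜 (deg G v) (atRound j v)

  mateAt-red : ∀ j v → red G v ≡ true →
    mateAt j v ≡ (if acc j v then fromℕ? (deg G v) (prop j v) else nothing)
  mateAt-red j v v-red rewrite isRed-atRound j v | v-red = refl

  mateAt-blue : ∀ j v → red G v ≡ false → mateAt j v ≡ (held j v >>= fromℕ? (deg G v))
  mateAt-blue j v v-blue rewrite isRed-atRound j v | v-blue = refl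

  prop-≤-suc : ∀ j r → red G r ≡ true → prop j r ℕ.≤ prop (suc j) r
  prop-≤-suc j r r-red with redStep j r r-red
  ... | exhausted _ prop≡ _       = ℕ.≤-reflexive (sym prop≡)
  ... | accepted-by _ _ _ prop≡ _ = ℕ.≤-reflexive (sym prop≡)
  ... | rejected-by _ _ _ prop≡ _ = ℕ.≤-trans (ℕ.n≤1+n _) (ℕ.≤-reflexive (sym prop≡))

  out-≡-mateAt : ∀ v → out 𝒜 G v ≡ mateAt K v
  out-≡-mateAt v = cong (output 𝒜 (deg G v)) (sym (atRound-≡-run K v))

-- Invariants of the execution

module _ {G : BGraph} (W : Weighting G) where

  wt-nonNeg : ∀ v i → 0ℚ ≤ wt W v i
  wt-nonNeg v i = <⇒≤ (positive⁻¹ (wt W v i) {{pos W v i}})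

  wt-antitone : ∀ v {i k : Fin (deg G v)} → toℕ i ℕ.≤ toℕ k → wt W v k ≤ wt W v i
  wt-antitone v {i} {k} i≤k with ℕ.m≤n⇒m<n∨m≡n i≤k
  ... | inj₁ i<k = pref W v i k i<k
  ... | inj₂ i≡k rewrite toℕ-injective i≡k = ≤-refl

module Invariants (K : ℕ) (G : BGraph) (W : Weighting G) where

  open Execution K G

  private
    N = n G

  record Invariant (j : ℕ) : Set where
    field
      held⇒accepted : ∀ b → red G b ≡ false → ∀ {i} → held j b ≡ just i →
        Σ (Fin (deg G b)) λ k →
          toℕ k ≡ i × prop j (nbr G b k) ≡ toℕ (back G b k) × acc j (nbr G b k) ≡ true
      accepted⇒held : ∀ r → red G r ≡ true → acc j r ≡ true →
        Σ (Fin (deg G r)) λ k →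
          fromℕ? (deg G r) (prop j r) ≡ just k × held j (nbr G r k) ≡ just (toℕ (back G r k))
      passed⇒dominated : ∀ r → red G r ≡ true → ∀ q → toℕ q ℕ.< prop j r →
        Σ (Fin (deg G (nbr G r q))) λ i →
          held j (nbr G r q) ≡ just (toℕ i) × wt W r q ≤ wt W (nbr G r q) i
  open Invariant public

  held-proposes : ∀ j → Invariant j → ∀ b → red G b ≡ false → ∀ {k} → held j b ≡ just (toℕ k) →
    proposes j b k ≡ true
  held-proposes j inv b b-blue {k} held≡k with held⇒accepted inv b b-blue held≡k
  ... | k′ , k′≡k , prop≡ , _ rewrite toℕ-injective k′≡k = dec-true (_ ℕ.≟ _) (sym prop≡)

  held-improves : ∀ j → Invariant j → ∀ b → red G b ≡ false → ∀ {i} → held j b ≡ just (toℕ i) →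
    Σ (Fin (deg G b)) λ i′ → held (suc j) b ≡ just (toℕ i′) × wt W b i ≤ wt W b i′
  held-improves j inv b b-blue held≡i with held-suc-≤ j b b-blue (held-proposes j inv b b-blue held≡i)
  ... | i′ , held≡i′ , i′≤i = i′ , held≡i′ , wt-antitone W b i′≤i

  rejection-dominated : ∀ j r → red G r ≡ true → ∀ {k} → fromℕ? (deg G r) (prop j r) ≡ just k →
    held (suc j) (nbr G r k) ≢ just (toℕ (back G r k)) →
    Σ (Fin (deg G (nbr G r k))) λ i →
      held (suc j) (nbr G r k) ≡ just (toℕ i) × wt W r k ≤ wt W (nbr G r k) i
  rejection-dominated j r r-red {k} port held≢
    with held-suc-≤ j (nbr G r k) (nbr-blue G k r-red) (proposes-back j r port)
  ... | i , held≡i , i≤back =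
    i , held≡i , ≤-trans (≤-reflexive (sym (wt-sym W r k))) (pref W _ i (back G r k) i<back)
    where
    i<back : toℕ i ℕ.< toℕ (back G r k)
    i<back = ℕ.≤∧≢⇒< i≤back (λ i≡back → held≢ (trans held≡i (cong just i≡back)))

  module _ (j : ℕ) (b : Fin N) (b-blue : red G b ≡ false) {k} (best : bestProposal j b ≡ just k) where

    private
      back≡prop : toℕ (back G b k) ≡ prop j (nbr G b k)
      back≡prop = proposes-true j b k (firstTrue-true (deg G b) (proposes j b) best)
      port : fromℕ? (deg G (nbr G b k)) (prop j (nbr G b k)) ≡ just (back G b k)
      port = trans (cong (fromℕ? _) (sym back≡prop)) (fromℕ?-toℕ (back G b k))

    best-accepted : prop (suc j) (nbr G b k) ≡ toℕ (back G b k) × acc (suc j) (nbr G b k) ≡ true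
    best-accepted with redStep j (nbr G b k) (nbr-red G k b-blue)
    ... | exhausted none _ _ = contradiction (trans (sym port) none) λ ()
    ... | accepted-by _ _ _ prop≡ acc≡ = trans prop≡ (sym back≡prop) , acc≡
    ... | rejected-by k′ port′ held≢ _ _ with Maybe.just-injective (trans (sym port) port′)
    ...   | refl = contradiction (held-back (suc j) b (held-suc-≡ j b b-blue best)) held≢

  held⇒accepted-suc : ∀ j b → red G b ≡ false → ∀ {i} → held (suc j) b ≡ just i →
    Σ (Fin (deg G b)) λ k →
      toℕ k ≡ i × prop (suc j) (nbr G b k) ≡ toℕ (back G b k) × acc (suc j) (nbr G b k) ≡ true
  held⇒accepted-suc j b b-blue held≡i with bestProposal j b in best
  ... | nothing = contradiction (trans (sym held≡i) (held-suc-≡ j b b-blue best)) λ ()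
  ... | just k  = k , Maybe.just-injective (trans (sym (held-suc-≡ j b b-blue best)) held≡i)
                    , best-accepted j b b-blue best

  accepted⇒held-suc : ∀ j r → red G r ≡ true → acc (suc j) r ≡ true →
    Σ (Fin (deg G r)) λ k →
      fromℕ? (deg G r) (prop (suc j) r) ≡ just k × held (suc j) (nbr G r k) ≡ just (toℕ (back G r k))
  accepted⇒held-suc j r r-red acc≡ with redStep j r r-red
  ... | exhausted _ _ acc≢               = contradiction (trans (sym acc≡) acc≢) λ ()
  ... | accepted-by k port held≡ prop≡ _ = k , trans (cong (fromℕ? _) prop≡) port , held≡
  ... | rejected-by _ _ _ _ acc≢         = contradiction (trans (sym acc≡) acc≢) λ ()

  passed⇒dominated-suc : ∀ j → Invariant j → ∀ r → red G r ≡ true → ∀ q → toℕ q ℕ.< prop (suc j) r →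
    Σ (Fin (deg G (nbr G r q))) λ i →
      held (suc j) (nbr G r q) ≡ just (toℕ i) × wt W r q ≤ wt W (nbr G r q) i
  passed⇒dominated-suc j inv r r-red q q<prop′ with toℕ q ℕ.<? prop j r
  ... | yes q<prop with passed⇒dominated inv r r-red q q<prop
  ...   | i , held≡i , wq≤wi with held-improves j inv (nbr G r q) (nbr-blue G q r-red) held≡i
  ...     | i′ , held≡i′ , wi≤wi′ = i′ , held≡i′ , ≤-trans wq≤wi wi≤wi′
  passed⇒dominated-suc j inv r r-red q q<prop′ | no q≮prop with redStep j r r-red
  ... | exhausted _ prop≡ _       = contradiction (subst (toℕ q ℕ.<_) prop≡ q<prop′) q≮prop
  ... | accepted-by _ _ _ prop≡ _ = contradiction (subst (toℕ q ℕ.<_) prop≡ q<prop′) q≮prop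
  ... | rejected-by k port held≢ prop≡ _ with toℕ-injective (trans q≡prop (sym (fromℕ?-just _ _ port)))
    where
    q≡prop : toℕ q ≡ prop j r
    q≡prop = ℕ.≤-antisym (ℕ.s≤s⁻¹ (subst (toℕ q ℕ.<_) prop≡ q<prop′)) (ℕ.≮⇒≥ q≮prop)
  ...   | refl = rejection-dominated j r r-red port held≢

  invariant : ∀ j → Invariant j
  invariant zero    = record
    { held⇒accepted    = λ b _ held≡ → contradiction (trans (sym (held-zero b)) held≡) λ ()
    ; accepted⇒held    = λ r _ acc≡ → contradiction (trans (sym (acc-zero r)) acc≡) λ ()
    ; passed⇒dominated = λ r _ q q<prop → contradiction (subst (toℕ q ℕ.<_) (prop-zero r) q<prop) λ ()
    }
  invariant (suc j) = record
    { held⇒accepted    = held⇒accepted-suc j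
    ; accepted⇒held    = accepted⇒held-suc j
    ; passed⇒dominated = passed⇒dominated-suc j (invariant j)
    }
  mateAt-isMatching : ∀ j → IsMatching G (mateAt j)
  mateAt-isMatching j v i mate≡i with red G v in v-colour
  ... | true with if-just (trans (sym (mateAt-red j v v-colour)) mate≡i)
  ...   | acc≡ , port with accepted⇒held (invariant j) v v-colour acc≡
  ...     | k , port′ , held≡ with Maybe.just-injective (trans (sym port′) port)
  ...       | refl = begin
    mateAt j (nbr G v k)              ≡⟨ mateAt-blue j (nbr G v k) (nbr-blue G k v-colour) ⟩
    (held j (nbr G v k) >>= fromℕ? _)  ≡⟨ cong (_>>= fromℕ? _) held≡ ⟩
    fromℕ? _ (toℕ (back G v k))       ≡⟨ fromℕ?-toℕ (back G v k) ⟩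
    just (back G v k)                 ∎
    where open ≡-Reasoning
  mateAt-isMatching j v i mate≡i | false with >>=-just (held j v) (trans (sym (mateAt-blue j v v-colour)) mate≡i)
  ... | m , held≡m , port with held⇒accepted (invariant j) v v-colour held≡m
  ...   | k , k≡m , prop≡ , acc≡ with toℕ-injective (trans k≡m (sym (fromℕ?-just _ _ port)))
  ...     | refl = begin
    mateAt j (nbr G v k)
      ≡⟨ mateAt-red j (nbr G v k) (nbr-red G k v-colour) ⟩
    (if acc j (nbr G v k) then fromℕ? _ (prop j (nbr G v k)) else nothing)
      ≡⟨ cong₂ (λ a p → if a then fromℕ? _ p else nothing) acc≡ prop≡ ⟩
    fromℕ? _ (toℕ (back G v k))
      ≡⟨ fromℕ?-toℕ (back G v k) ⟩
    just (back G v k) ∎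
    where open ≡-Reasoning

-- Charging

module _ (G : BGraph) where

  partner : Mate G → Fin (n G) → Maybe (Fin (n G))
  partner m v = Maybe.map (nbr G v) (m v)

  module _ {m : Mate G} (m-matching : IsMatching G m) where

    partner-back : ∀ {a s} → partner m a ≡ just s →
      Σ (Fin (deg G s)) λ k → m s ≡ just k × nbr G s k ≡ a
    partner-back {a} eq with map-just⁻¹ (m a) eq
    ... | q , ma≡q , refl = back G a q , m-matching a q ma≡q , back-ok G a q

    partner-injective : PartialInjective (partner m)
    partner-injective eq eq′ with partner-back eq | partner-back eq′
    ... | k , ms≡k , a≡ | k′ , ms≡k′ , b≡ with Maybe.just-injective (trans (sym ms≡k) ms≡k′)
    ...   | refl = trans (sym a≡) b≡

    redPartner-injective : PartialInjective (λ v → if red G v then partner m v else nothing)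
    redPartner-injective = PartialInjective-⊆ partner-injective (proj₂ ∘′ if-just)

    bluePartner-injective : PartialInjective (λ v → if not (red G v) then partner m v else nothing)
    bluePartner-injective = PartialInjective-⊆ partner-injective (proj₂ ∘′ if-just)

module _ {G : BGraph} {m m′ : Mate G} (m≗m′ : ∀ v → m v ≡ m′ v) where

  IsMatching-cong : IsMatching G m → IsMatching G m′
  IsMatching-cong m-matching v i m′v≡i =
    trans (sym (m≗m′ (nbr G v i))) (m-matching v i (trans (m≗m′ v) m′v≡i))

  weight-cong : ∀ W → weight G W m ≡ weight G W m′
  weight-cong W = ΣFin-cong (n G) λ v →
    cong (λ x → if red G v then maybe (wt W v) 0ℚ x else 0ℚ) (m≗m′ v)

module _ {G : BGraph} (W : Weighting G) where

  private
    N = n G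

  edgeWeight : Mate G → Fin N → ℚ
  edgeWeight m v = maybe (wt W v) 0ℚ (m v)

  edgeWeight-nonNeg : ∀ m v → 0ℚ ≤ edgeWeight m v
  edgeWeight-nonNeg m v with m v
  ... | nothing = ≤-refl
  ... | just i  = wt-nonNeg W v i

  redEdgeWeight blueEdgeWeight : Mate G → Fin N → ℚ
  redEdgeWeight  m v = if red G v then edgeWeight m v else 0ℚ
  blueEdgeWeight m v = if red G v then 0ℚ else edgeWeight m v

  redEdgeWeight-nonNeg : ∀ m v → 0ℚ ≤ redEdgeWeight m v
  redEdgeWeight-nonNeg m v with red G v
  ... | true  = edgeWeight-nonNeg m v
  ... | false = ≤-refl

  blueEdgeWeight-nonNeg : ∀ m v → 0ℚ ≤ blueEdgeWeight m v
  blueEdgeWeight-nonNeg m v with red G v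
  ... | true  = ≤-refl
  ... | false = edgeWeight-nonNeg m v

  blueEdgeWeight-≤ : ∀ {m} → IsMatching G m → ∀ v →
    blueEdgeWeight m v ≤ maybe (redEdgeWeight m) 0ℚ (if not (red G v) then partner G m v else nothing)
  blueEdgeWeight-≤ {m} m-matching v with red G v in v-colour | m v in mv
  ... | true  | _       = ≤-refl
  ... | false | nothing = ≤-refl
  ... | false | just i  rewrite nbr-red G i v-colour | m-matching v i mv =
    ≤-reflexive (sym (wt-sym W v i))

  ΣFin-blueEdgeWeight-≤-weight : ∀ {m} → IsMatching G m → ΣFin N (blueEdgeWeight m) ≤ weight G W m
  ΣFin-blueEdgeWeight-≤-weight {m} m-matching = ≤-trans (ΣFin-mono-≤ N (blueEdgeWeight-≤ m-matching))
    (ΣFin-reindex-≤ N N _ (bluePartner-injective G m-matching) (redEdgeWeight-nonNeg m))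

module Charging (K : ℕ) (G : BGraph) (W : Weighting G) where

  open Execution K G
  open Invariants K G W

  private
    N = n G

  mateAt-held : ∀ j b → red G b ≡ false → ∀ {i} → held j b ≡ just (toℕ i) → mateAt j b ≡ just i
  mateAt-held j b b-blue {i} held≡i =
    trans (mateAt-blue j b b-blue) (trans (cong (_>>= fromℕ? _) held≡i) (fromℕ?-toℕ i))

  held-persists : ∀ d j b → red G b ≡ false → ∀ {i} → held j b ≡ just (toℕ i) →
    Σ (Fin (deg G b)) λ i′ → held (d ℕ.+ j) b ≡ just (toℕ i′) × wt W b i ≤ wt W b i′
  held-persists zero    j b b-blue held≡i = _ , held≡i , ≤-refl
  held-persists (suc d) j b b-blue held≡i with held-persists d j b b-blue held≡i
  ... | i′ , held≡i′ , wi≤wi′ with held-improves (d ℕ.+ j) (invariant (d ℕ.+ j)) b b-blue held≡i′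
  ...   | i″ , held≡i″ , wi′≤wi″ = i″ , held≡i″ , ≤-trans wi≤wi′ wi′≤wi″

  finalWeight : Fin N → ℚ
  finalWeight = blueEdgeWeight W (mateAt K)

  wt-≤-finalWeight : ∀ j → j ℕ.≤ K → ∀ b → red G b ≡ false → ∀ {i} → held j b ≡ just (toℕ i) →
    wt W b i ≤ finalWeight b
  wt-≤-finalWeight j j≤K b b-blue held≡i with held-persists (K ℕ.∸ j) j b b-blue held≡i
  ... | i′ , held≡i′ , wi≤wi′
    rewrite b-blue | mateAt-held K b b-blue (subst (λ t → held t b ≡ just (toℕ i′)) (ℕ.m∸n+n≡m j≤K) held≡i′)
    = wi≤wi′

  finalWeight-nonNeg : ∀ b → 0ℚ ≤ finalWeight b
  finalWeight-nonNeg = blueEdgeWeight-nonNeg W (mateAt K)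

  passedBelow : (r : Fin N) → ℕ → ℚ
  passedBelow r p = ΣFin (deg G r) (λ k → finalWeight (nbr G r k) when (toℕ k ℕ.<? p))

  passed : ℕ → Fin N → ℚ
  passed j r = passedBelow r (prop j r)

  passedWeight : ℕ → Fin N → ℚ
  passedWeight j r = if red G r then passed j r else 0ℚ

  partnerFinal : Mate G → Fin N → ℚ
  partnerFinal m r = maybe finalWeight 0ℚ (partner G m r)

  partnerWeight : Mate G → Fin N → ℚ
  partnerWeight m r = maybe finalWeight 0ℚ (if red G r then partner G m r else nothing)

  partnerFinal-nonNeg : ∀ m r → 0ℚ ≤ partnerFinal m r
  partnerFinal-nonNeg m r with partner G m r
  ... | nothing = ≤-refl
  ... | just b  = finalWeight-nonNeg b

  passed-mono-suc : ∀ j r → red G r ≡ true → passed j r ≤ passed (suc j) r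
  passed-mono-suc j r r-red = ΣFin-mono-≤ (deg G r) λ k →
    when-mono (finalWeight-nonNeg (nbr G r k)) (λ k<prop → ℕ.<-≤-trans k<prop (prop-≤-suc j r r-red))
      (toℕ k ℕ.<? prop j r) (toℕ k ℕ.<? prop (suc j) r)

  passed-≤-nbrs : ∀ j r → passed j r ≤ ΣFin (deg G r) (λ k → finalWeight (nbr G r k))
  passed-≤-nbrs j r = ΣFin-mono-≤ (deg G r) (λ k → when-≤ (toℕ k ℕ.<? prop j r) (finalWeight-nonNeg _))

  passed-rejected : ∀ j r k → prop j r ≡ toℕ k → prop (suc j) r ≡ suc (prop j r) →
    passed (suc j) r ≡ passed j r + finalWeight (nbr G r k)
  passed-rejected j r k prop≡k prop′≡ = begin
    passedBelow r (prop (suc j) r)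
      ≡⟨ cong (passedBelow r) (trans prop′≡ (cong suc prop≡k)) ⟩
    passedBelow r (suc (toℕ k))
      ≡⟨ ΣFin-<-suc (deg G r) (finalWeight ∘ nbr G r) k ⟩
    passedBelow r (toℕ k) + finalWeight (nbr G r k)
      ≡⟨ cong (λ p → passedBelow r p + finalWeight (nbr G r k)) prop≡k ⟨
    passed j r + finalWeight (nbr G r k) ∎
    where open ≡-Reasoning

  module _ (j : ℕ) (sj≤K : suc j ℕ.≤ K) (r : Fin N) (r-red : red G r ≡ true) where

    passed-charge : ∀ q → toℕ q ℕ.< prop (suc j) r → wt W r q ≤ finalWeight (nbr G r q)
    passed-charge q q<prop with passed⇒dominated (invariant (suc j)) r r-red q q<prop
    ... | i , held≡i , wq≤wi =
      ≤-trans wq≤wi (wt-≤-finalWeight (suc j) sj≤K (nbr G r q) (nbr-blue G q r-red) held≡i)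

    accepted-charge : acc (suc j) r ≡ true → ∀ q → prop (suc j) r ℕ.≤ toℕ q →
      wt W r q ≤ partnerFinal (mateAt (suc j)) r
    accepted-charge acc≡ q prop≤q with accepted⇒held (invariant (suc j)) r r-red acc≡
    ... | k , port , held≡ = begin
      wt W r q
        ≤⟨ wt-antitone W r (subst (ℕ._≤ toℕ q) (sym (fromℕ?-just _ _ port)) prop≤q) ⟩
      wt W r k
        ≡⟨ wt-sym W r k ⟨
      wt W (nbr G r k) (back G r k)
        ≤⟨ wt-≤-finalWeight (suc j) sj≤K (nbr G r k) (nbr-blue G k r-red) held≡ ⟩
      finalWeight (nbr G r k)
        ≡⟨ cong (maybe finalWeight 0ℚ ∘ Maybe.map (nbr G r)) mate≡k ⟨
      partnerFinal (mateAt (suc j)) r ∎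
      where
      open ≤-Reasoning
      mate≡k : mateAt (suc j) r ≡ just k
      mate≡k = trans (mateAt-red (suc j) r r-red)
        (trans (cong (λ a → if a then fromℕ? (deg G r) (prop (suc j) r) else nothing) acc≡) port)

    private
      acceptedShare : ℚ
      acceptedShare = partnerFinal (mateAt (suc j)) r
      acceptedShare≥0 : 0ℚ ≤ acceptedShare
      acceptedShare≥0 = partnerFinal-nonNeg (mateAt (suc j)) r
      no-port-beyond : ∀ q → fromℕ? (deg G r) (prop j r) ≡ nothing → ¬ (prop j r ℕ.≤ toℕ q)
      no-port-beyond q none p≤q = ℕ.<⇒≱ (toℕ<n q) (ℕ.≤-trans (fromℕ?-nothing _ _ none) p≤q)

    -- The weight of the edge r–q is paid for by the blue node that accepts r, by q
    -- itself if r has already passed q, or by the neighbour that refuses r this round.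
    charge-port : ∀ q → wt W r q + passed j r ≤
      (partnerFinal (mateAt (suc j)) r + finalWeight (nbr G r q)) + passed (suc j) r
    charge-port q with toℕ q ℕ.<? prop (suc j) r
    ... | yes q<prop = begin
      wt W r q + passed j r
        ≤⟨ +-mono-≤ (passed-charge q q<prop) (passed-mono-suc j r r-red) ⟩
      finalWeight (nbr G r q) + passed (suc j) r
        ≤⟨ +-monoˡ-≤ (passed (suc j) r) (p≤q+p acceptedShare≥0) ⟩
      (acceptedShare + finalWeight (nbr G r q)) + passed (suc j) r ∎
      where open ≤-Reasoning
    ... | no q≮prop with redStep j r r-red
    ...   | exhausted none prop≡ _ =
      contradiction (subst (ℕ._≤ toℕ q) prop≡ (ℕ.≮⇒≥ q≮prop)) (no-port-beyond q none)
    ...   | accepted-by _ _ _ _ acc≡ = begin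
      wt W r q + passed j r
        ≤⟨ +-mono-≤ (accepted-charge acc≡ q (ℕ.≮⇒≥ q≮prop)) (passed-mono-suc j r r-red) ⟩
      acceptedShare + passed (suc j) r
        ≤⟨ +-monoˡ-≤ (passed (suc j) r) (p≤p+q {acceptedShare} (finalWeight-nonNeg (nbr G r q))) ⟩
      (acceptedShare + finalWeight (nbr G r q)) + passed (suc j) r ∎
      where open ≤-Reasoning
    ...   | rejected-by k port _ prop≡ _ = begin
      wt W r q + passed j r                ≤⟨ +-monoˡ-≤ (passed j r) wq≤fk ⟩
      finalWeight (nbr G r k) + passed j r ≡⟨ +-comm (finalWeight (nbr G r k)) (passed j r) ⟩
      passed j r + finalWeight (nbr G r k) ≡⟨ sym (passed-rejected j r k k≡prop prop≡) ⟩
      passed (suc j) r                     ≤⟨ p≤q+p (nonNeg+ acceptedShare≥0 (finalWeight-nonNeg _)) ⟩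
      (acceptedShare + finalWeight (nbr G r q)) + passed (suc j) r ∎
      where
      open ≤-Reasoning
      k≡prop : prop j r ≡ toℕ k
      k≡prop = sym (fromℕ?-just _ _ port)
      k<prop′ : toℕ k ℕ.< prop (suc j) r
      k<prop′ = subst (toℕ k ℕ.<_) (sym prop≡) (subst (ℕ._< suc (prop j r)) k≡prop (ℕ.n<1+n _))
      wq≤fk : wt W r q ≤ finalWeight (nbr G r k)
      wq≤fk = ≤-trans (wt-antitone W r (ℕ.<⇒≤ (ℕ.<-≤-trans k<prop′ (ℕ.≮⇒≥ q≮prop)))) (passed-charge k k<prop′)

  passedWeight-nonNeg : ∀ j r → 0ℚ ≤ passedWeight j r
  passedWeight-nonNeg j r with red G r
  ... | true  = ΣFin-nonNeg (deg G r) (λ k → when-nonNeg (toℕ k ℕ.<? prop j r) (finalWeight-nonNeg _))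
  ... | false = ≤-refl

  passedWeight-≤-nbrs : ∀ j r → passedWeight j r ≤ ΣFin (deg G r) (λ k → finalWeight (nbr G r k))
  passedWeight-≤-nbrs j r with red G r
  ... | true  = passed-≤-nbrs j r
  ... | false = ΣFin-nonNeg (deg G r) (λ k → finalWeight-nonNeg (nbr G r k))

  round-≤ : ∀ j → suc j ℕ.≤ K → ∀ m r →
    redEdgeWeight W m r + passedWeight j r ≤
    (partnerWeight (mateAt (suc j)) r + partnerWeight m r) + passedWeight (suc j) r
  round-≤ j sj≤K m r with red G r in r-colour
  ... | false = ≤-refl
  ... | true with m r
  ...   | just q  = charge-port j sj≤K r r-colour q
  ...   | nothing = begin
    0ℚ + passed j r               ≡⟨ +-identityˡ (passed j r) ⟩
    passed j r                    ≤⟨ passed-mono-suc j r r-colour ⟩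
    passed (suc j) r              ≤⟨ p≤q+p (nonNeg+ (partnerFinal-nonNeg (mateAt (suc j)) r) ≤-refl) ⟩
    (partnerFinal (mateAt (suc j)) r + 0ℚ) + passed (suc j) r ∎
    where open ≤-Reasoning

  totalFinal : ℚ
  totalFinal = ΣFin N finalWeight

  totalPassed : ℕ → ℚ
  totalPassed j = ΣFin N (passedWeight j)

  ΣFin-partnerWeight-≤ : ∀ {m} → IsMatching G m → ΣFin N (partnerWeight m) ≤ totalFinal
  ΣFin-partnerWeight-≤ m-matching =
    ΣFin-reindex-≤ N N _ (redPartner-injective G m-matching) finalWeight-nonNeg

  round-sum-≤ : ∀ j → suc j ℕ.≤ K → ∀ {m} → IsMatching G m →
    weight G W m + totalPassed j ≤ (totalFinal + totalFinal) + totalPassed (suc j)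
  round-sum-≤ j sj≤K {m} m-matching = begin
    weight G W m + totalPassed j
      ≡⟨ sym (ΣFin-+ N (redEdgeWeight W m) (passedWeight j)) ⟩
    ΣFin N (λ r → redEdgeWeight W m r + passedWeight j r)
      ≤⟨ ΣFin-mono-≤ N (round-≤ j sj≤K m) ⟩
    ΣFin N (λ r → (partnerWeight (mateAt (suc j)) r + partnerWeight m r) + passedWeight (suc j) r)
      ≡⟨ trans (ΣFin-+ N _ (passedWeight (suc j))) (cong (_+ totalPassed (suc j)) (ΣFin-+ N _ _)) ⟩
    (ΣFin N (partnerWeight (mateAt (suc j))) + ΣFin N (partnerWeight m)) + totalPassed (suc j)
      ≤⟨ +-monoˡ-≤ (totalPassed (suc j))
           (+-mono-≤ (ΣFin-partnerWeight-≤ (mateAt-isMatching (suc j))) (ΣFin-partnerWeight-≤ m-matching)) ⟩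
    (totalFinal + totalFinal) + totalPassed (suc j) ∎
    where open ≤-Reasoning

  totalPassed-≤ : ∀ j Δ → (∀ v → deg G v ℕ.≤ Δ) → totalPassed j ≤ ℕtoℚ Δ * totalFinal
  totalPassed-≤ j Δ deg≤Δ =
    ≤-trans (ΣFin-mono-≤ N (passedWeight-≤-nbrs j)) (ΣFin-nbr-≤ G Δ deg≤Δ finalWeight-nonNeg)

  K*weight-≤ : ∀ Δ → (∀ v → deg G v ℕ.≤ Δ) → ∀ {m} → IsMatching G m →
    ℕtoℚ K * weight G W m ≤
    ℕtoℚ K * (weight G W (mateAt K) + weight G W (mateAt K)) + ℕtoℚ Δ * weight G W (mateAt K)
  K*weight-≤ Δ deg≤Δ {m} m-matching = begin
    ℕtoℚ K * weight G W m
      ≤⟨ p≤p+q (ΣFin-nonNeg N (passedWeight-nonNeg 0)) ⟩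
    ℕtoℚ K * weight G W m + totalPassed 0
      ≤⟨ telescope K totalPassed (λ j j<K → round-sum-≤ j j<K m-matching) ⟩
    ℕtoℚ K * (totalFinal + totalFinal) + totalPassed K
      ≤⟨ +-monoʳ-≤ (ℕtoℚ K * (totalFinal + totalFinal)) (totalPassed-≤ K Δ deg≤Δ) ⟩
    ℕtoℚ K * (totalFinal + totalFinal) + ℕtoℚ Δ * totalFinal
      ≤⟨ +-mono-≤ (*-monoˡ-≤-nonNeg (ℕtoℚ K) {{ℚ.nonNegative (ℕtoℚ-nonNeg K)}} (+-mono-≤ F≤W F≤W))
                  (*-monoˡ-≤-nonNeg (ℕtoℚ Δ) {{ℚ.nonNegative (ℕtoℚ-nonNeg Δ)}} F≤W) ⟩
    ℕtoℚ K * (weight G W (mateAt K) + weight G W (mateAt K)) + ℕtoℚ Δ * weight G W (mateAt K) ∎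
    where
    open ≤-Reasoning
    F≤W : totalFinal ≤ weight G W (mateAt K)
    F≤W = ΣFin-blueEdgeWeight-≤-weight W (mateAt-isMatching K)

twice≡+ : ∀ k → twice k ≡ k ℕ.+ k
twice≡+ zero    = refl
twice≡+ (suc k) = cong suc (trans (cong suc (twice≡+ k)) (sym (ℕ.+-suc k k)))

ℕtoℚ-twice : ∀ k → ℕtoℚ (twice k) ≡ ℕtoℚ 2 * ℕtoℚ k
ℕtoℚ-twice k = begin
  ℕtoℚ (twice k)          ≡⟨ cong ℕtoℚ (twice≡+ k) ⟩
  ℕtoℚ (k ℕ.+ k)          ≡⟨ ℕtoℚ-+ k k ⟩
  ℕtoℚ k + ℕtoℚ k         ≡⟨ sym (two-≡ (ℕtoℚ k)) ⟩
  (1ℚ + 1ℚ) * ℕtoℚ k      ∎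
  where
  open ≡-Reasoning
  open +-*-Solver
  -- `ℕtoℚ 2` and `1ℚ + 1ℚ` have the same normal form; this is also used in `approximation`.
  two-≡ : ∀ a → (1ℚ + 1ℚ) * a ≡ a + a
  two-≡ = solve 1 (λ a → (con 1ℚ :+ con 1ℚ) :* a := a :+ a) refl

-- Choosing the number of rounds

module _ (ε : ℚ) .{{_ : Positive ε}} (Δ : ℕ) where

  private
    instance
      ε≢0 = pos⇒nonZero ε
    Δ/ε≥0 : 0ℚ ≤ ℕtoℚ Δ ÷ ε
    Δ/ε≥0 = nonNegative⁻¹ _ {{nonNeg*nonNeg⇒nonNeg (ℕtoℚ Δ) {{ℚ.nonNegative (ℕtoℚ-nonNeg Δ)}} (1/ ε)
                                {{pos⇒nonNeg (1/ ε) {{1/pos⇒pos ε}}}}}}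

  enough-rounds : Σ ℕ λ K → Positive (ℕtoℚ K) × ℕtoℚ Δ ≤ ℕtoℚ K * ε ×
                  ℕtoℚ (twice K) ≤ ℕtoℚ 4 + (ℕtoℚ 2 * ℕtoℚ Δ) ÷ ε
  enough-rounds with ∃-floor (ℕtoℚ Δ ÷ ε) Δ/ε≥0
  ... | q , q≤Δ/ε , Δ/ε≤1+q = suc q , ℕtoℚ-pos q , Δ≤Kε , rounds-≤
    where
    open ≤-Reasoning
    open +-*-Solver
    Δ≤Kε : ℕtoℚ Δ ≤ ℕtoℚ (suc q) * ε
    Δ≤Kε = begin
      ℕtoℚ Δ                ≡⟨ sym (*-identityʳ (ℕtoℚ Δ)) ⟩
      ℕtoℚ Δ * 1ℚ           ≡⟨ cong (ℕtoℚ Δ *_) (sym (*-inverseˡ ε)) ⟩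
      ℕtoℚ Δ * (1/ ε * ε)   ≡⟨ sym (*-assoc (ℕtoℚ Δ) (1/ ε) ε) ⟩
      (ℕtoℚ Δ ÷ ε) * ε      ≤⟨ *-monoʳ-≤-nonNeg ε {{pos⇒nonNeg ε}} Δ/ε≤1+q ⟩
      ℕtoℚ (suc q) * ε      ∎
    rounds-≤ : ℕtoℚ (twice (suc q)) ≤ ℕtoℚ 4 + (ℕtoℚ 2 * ℕtoℚ Δ) ÷ ε
    rounds-≤ = begin
      ℕtoℚ (twice (suc q))
        ≡⟨ trans (ℕtoℚ-twice (suc q)) (cong (ℕtoℚ 2 *_) (ℕtoℚ-suc q)) ⟩
      ℕtoℚ 2 * (1ℚ + ℕtoℚ q)
        ≤⟨ *-monoˡ-≤-nonNeg (ℕtoℚ 2) (+-monoʳ-≤ 1ℚ q≤Δ/ε) ⟩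
      ℕtoℚ 2 * (1ℚ + ℕtoℚ Δ ÷ ε)
        ≤⟨ p≤p+q (ℕtoℚ-nonNeg 2) ⟩
      ℕtoℚ 2 * (1ℚ + ℕtoℚ Δ ÷ ε) + ℕtoℚ 2
        ≡⟨ ring (ℕtoℚ 2) (ℕtoℚ Δ) (1/ ε) ⟩
      (ℕtoℚ 2 + ℕtoℚ 2) + (ℕtoℚ 2 * ℕtoℚ Δ) ÷ ε
        ≡⟨ cong (_+ (ℕtoℚ 2 * ℕtoℚ Δ) ÷ ε) (ℕtoℚ-+ 2 2) ⟨
      ℕtoℚ 4 + (ℕtoℚ 2 * ℕtoℚ Δ) ÷ ε ∎
      where
      ring : ∀ t d e → t * (1ℚ + d * e) + t ≡ (t + t) + (t * d) * e
      ring = solve 3 (λ t d e → t :* (con 1ℚ :+ d :* e) :+ t := (t :+ t) :+ (t :* d) :* e) refl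

module _ (K : ℕ) {G : BGraph} (W : Weighting G) where

  open Execution K G using (mateAt; out-≡-mateAt)

  private
    𝒜 = proposalAlgorithm K

  out-isMatching : IsMatching G (out 𝒜 G)
  out-isMatching =
    IsMatching-cong {G} {mateAt K} (λ v → sym (out-≡-mateAt v)) (Invariants.mateAt-isMatching K G W K)

  approximation : ∀ {Δ ε} → Positive (ℕtoℚ K) → ℕtoℚ Δ ≤ ℕtoℚ K * ε → (∀ v → deg G v ℕ.≤ Δ) →
    ∀ {m} → IsMatching G m → weight G W m ≤ (ℕtoℚ 2 + ε) * weight G W (mateAt K)
  approximation {Δ} {ε} K>0 Δ≤Kε deg≤Δ {m} m-matching = *-cancelˡ-≤-pos (ℕtoℚ K) {{K>0}} (begin
    ℕtoℚ K * weight G W m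
      ≤⟨ Charging.K*weight-≤ K G W Δ deg≤Δ m-matching ⟩
    ℕtoℚ K * (Wₘ + Wₘ) + ℕtoℚ Δ * Wₘ
      ≤⟨ +-monoʳ-≤ (ℕtoℚ K * (Wₘ + Wₘ)) (*-monoʳ-≤-nonNeg Wₘ {{ℚ.nonNegative Wₘ≥0}} Δ≤Kε) ⟩
    ℕtoℚ K * (Wₘ + Wₘ) + ℕtoℚ K * ε * Wₘ
      ≡⟨ ring (ℕtoℚ K) ε Wₘ ⟩
    ℕtoℚ K * ((ℕtoℚ 2 + ε) * Wₘ) ∎)
    where
    open ≤-Reasoning
    open +-*-Solver
    Wₘ = weight G W (mateAt K)
    Wₘ≥0 : 0ℚ ≤ Wₘ
    Wₘ≥0 = ΣFin-nonNeg (n G) (redEdgeWeight-nonNeg W (mateAt K))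
    ring : ∀ k e w → k * (w + w) + k * e * w ≡ k * (((1ℚ + 1ℚ) + e) * w)
    ring = solve 3 (λ k e w → k :* (w :+ w) :+ k :* e :* w := k :* (((con 1ℚ :+ con 1ℚ) :+ e) :* w))
                   refl

  out-approximation : ∀ {Δ ε} → Positive (ℕtoℚ K) → ℕtoℚ Δ ≤ ℕtoℚ K * ε → (∀ v → deg G v ℕ.≤ Δ) →
    ∀ {m} → IsMatching G m → weight G W m ≤ (ℕtoℚ 2 + ε) * weight G W (out 𝒜 G)
  out-approximation {Δ} {ε} K>0 Δ≤Kε deg≤Δ {m} m-matching =
    subst (λ w → weight G W m ≤ (ℕtoℚ 2 + ε) * w)
          (weight-cong {G} {mateAt K} {out 𝒜 G} (λ v → sym (out-≡-mateAt v)) W)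
          (approximation K>0 Δ≤Kε deg≤Δ m-matching)

theorem2 : (ε : ℚ) → .{{_ : Positive ε}} → (Δ : ℕ) → .{{_ : NonZero Δ}} →
  Σ Algorithm λ A →
    (ℕtoℚ (T A) ≤ ℕtoℚ 4 + _÷_ (ℕtoℚ 2 * ℕtoℚ Δ) ε {{pos⇒nonZero ε}}) ×
    ((G : BGraph) → MaxDegree G Δ → (W : Weighting G) →
      IsMatching G (out A G) ×
      ((Mstar : Mate G) → IsMaxWeightMatching G W Mstar →
        weight G W Mstar ≤ (ℕtoℚ 2 + ε) * weight G W (out A G)))
theorem2 ε Δ =
  let K , K>0 , Δ≤Kε , rounds≤ = enough-rounds ε Δ in
  proposalAlgorithm K , rounds≤ , λ G (deg≤Δ , _) W →
    out-isMatching K W , λ _ (M*-matching , _) → out-approximation K W K>0 Δ≤Kε deg≤Δ M*-matching
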